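{- Let $\mathbf z$ be the infinite fixed point, starting with $a$, of the morphism $h$ with $h(a)=aab$, $h(b)=b$. For any factor $w$ of $\mathbf z$, a longest $b$-run in $w$ has at most three occurrences in $w$. When it has three, the occurrences are a prefix of $w$, a suffix of $w$, and a single interior occurrence; in this case the $b$-run is $b^n$ for some $n\ge 1$ and $w=b^n h^{n+1}(a)b^{ -1}$, which has length $2^{n+2}+n-2$.
   Context: A factor of an infinite word is a finite contiguous block of it. A $b$-run of a word $w$ is a maximal occurrence of a block of consecutive $b$'s in $w$ (not extendable within $w$ by a $b$ on either side); an occurrence is interior if it is neither a prefix nor a suffix of $w$. Here $h^0(a)=a$, $h^{k}(a)=h(h^{k-1}(a))$, and for a word $x=yb$ ending in the letter $b$, $xb^{ -1}$ denotes $y$. -}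

module Defs where

open import Data.Nat using (ℕ; zero; suc; _+_; _≤_)
open import Data.List using (List; []; _∷_; _++_; drop; take; replicate; concatMap)
open import Data.Product using (Σ; ∃; ∃-syntax; _×_)
open import Data.Sum using (_⊎_)
open import Relation.Binary.PropositionalEquality using (_≡_)
open import Relation.Nullary using (¬_)

data Letter : Set where
  a b : Letter

Word : Set
Word = List Letter

hL : Letter → Word
hL a = a ∷ a ∷ b ∷ []
hL b = b ∷ []

h : Word → Word
h = concatMap hL

hPow : ℕ → Word
hPow zero = a ∷ []
hPow (suc k) = h (hPow k)

-- i-th letter of a word (default a if out of range; never used out of range below)
nth : Word → ℕ → Letter
nth [] _ = a
nth (x ∷ _) zero = x
nth (_ ∷ xs) (suc i) = nth xs i

-- the infinite fixed point z of h starting with a: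
-- z(i) is the i-th letter of h^(i+1)(a), which has length 2^(i+2)-1 > i
z : ℕ → Letter
z i = nth (hPow (suc i)) i

slice : ℕ → ℕ → Word
slice i zero = []
slice i (suc m) = z i ∷ slice (suc i) m

Factor : Word → Set
Factor w = ∃[ i ] ∃[ m ] (w ≡ slice i m)

At : Word → ℕ → Letter → Set
At w j c = ∃[ r ] (drop j w ≡ c ∷ r)

RunOcc : Word → ℕ → ℕ → Set
RunOcc w i k =
  (1 ≤ k)
  × (k + i ≤ Data.List.length w)
  × (take k (drop i w) ≡ replicate k b)
  × ((i ≡ 0) ⊎ (∃[ j ] ((i ≡ suc j) × ¬ At w j b)))
  × ¬ At w (i + k) b

LongestRun : Word → ℕ → Set
LongestRun w n = (∃[ i ] RunOcc w i n) × (∀ i k → RunOcc w i k → k ≤ n)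

module Submission where

-- Let b^N (N ≥ 1) be a longest run of a factor w, and let D N be the word with
-- h^N(a) = D N a b^N.  Desubstitution lemmas lift factorisations of h X to
--     factorisations of X; with them, an isolated block a b^N a of h^K(a) is
--     preceded by D N or by b^(N+1) D N and followed by a word comparable with
--     h^N(a) b = D N a b^(N+1) (lemma context); and D N a contains no b^N.
--  2. Every h^K(a) is a prefix of z, so these facts hold in z (zContext), phrased
--     with occurrences Occ p u and blocks Bs p k of b's at position p.
--  3. Every block of b's lies in a run, so no block b^(N+1) fits in w; a run of w
--     read in z is a block Bs with an a or the end of w on each side (RunInZ).
--  4. For three occurrences i₁ < i₂ < i₃ of b^N, the middle one is isolated; its
--     right context makes the third the start of the b^(N+1) after D a, ending w,
--     and its left context makes the first the tail of the b^(N+1) before D,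
--     starting w.  So w = b^N h^N(a) h^N(a), i.e. w b = b^N h^(N+1)(a), of length
--     2^(N+2) + N - 2, and a fourth occurrence cannot fit after the third.

open import Defs
open import Data.Nat using (ℕ; _+_; _∸_; _^_; _<_)
open import Data.List using (List; []; _∷_; _++_; replicate; length)
open import Data.Product using (_×_)
open import Data.Empty using (⊥)
open import Relation.Binary.PropositionalEquality using (_≡_; _≢_)

open import Data.Nat using (zero; suc; _*_; _≤_; z≤n; s≤s)
open import Data.Nat.Properties
open import Data.Nat.Tactic.RingSolver using (solve-∀)
open import Data.List using (take; drop)
open import Data.List.Properties using (++-assoc; ++-identityʳ; ∷-injectiveˡ; ∷-injectiveʳ; length-++; length-replicate)
open import Data.Product using (∃-syntax; _,_; proj₁; proj₂)
open import Data.Sum using (_⊎_; inj₁; inj₂)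
open import Data.Empty using (⊥-elim)
open import Function using (case_of_)
open import Relation.Nullary using (¬_)
open import Relation.Binary using (tri<; tri≈; tri>)
open import Relation.Binary.PropositionalEquality
open ≡-Reasoning

h-++ : ∀ x y → h (x ++ y) ≡ h x ++ h y
h-++ []      y = refl
h-++ (c ∷ x) y = trans (cong (hL c ++_) (h-++ x y)) (sym (++-assoc (hL c) (h x) (h y)))

h-bs : ∀ n → h (replicate n b) ≡ replicate n b
h-bs zero    = refl
h-bs (suc n) = cong (b ∷_) (h-bs n)

-- Both hL a and hL b end with b, so the image of a nonempty word ends with b.
h-ends-with-b : ∀ c x → ∃[ y ] h (c ∷ x) ≡ y ++ b ∷ []
h-ends-with-b a []       = a ∷ a ∷ [] , refl
h-ends-with-b b []       = [] , refl
h-ends-with-b c (c' ∷ x) with h-ends-with-b c' x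
... | y , e = hL c ++ y , trans (cong (hL c ++_) e) (sym (++-assoc (hL c) y (b ∷ [])))

hPow-starts-with-a : ∀ k → ∃[ t ] hPow k ≡ a ∷ t
hPow-starts-with-a zero    = [] , refl
hPow-starts-with-a (suc k) with hPow-starts-with-a k
... | t , e = a ∷ b ∷ h t , cong h e

hPow-suc : ∀ k → hPow (suc k) ≡ hPow k ++ hPow k ++ b ∷ []
hPow-suc zero    = refl
hPow-suc (suc k) = begin
  h (hPow (suc k))                        ≡⟨ cong h (hPow-suc k) ⟩
  h (hPow k ++ hPow k ++ b ∷ [])          ≡⟨ h-++ (hPow k) _ ⟩
  h (hPow k) ++ h (hPow k ++ b ∷ [])      ≡⟨ cong (h (hPow k) ++_) (h-++ (hPow k) (b ∷ [])) ⟩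
  h (hPow k) ++ h (hPow k) ++ b ∷ []      ∎

hPow-length : ∀ k → suc (length (hPow k)) ≡ 2 ^ suc k
hPow-length zero    = refl
hPow-length (suc k) = begin
  suc (length (hPow (suc k)))                       ≡⟨ cong (λ w → suc (length w)) (hPow-suc k) ⟩
  suc (length (hPow k ++ hPow k ++ b ∷ []))         ≡⟨ cong suc (length-++ (hPow k)) ⟩
  suc (L + length (hPow k ++ b ∷ []))               ≡⟨ cong (λ l → suc (L + l)) (length-++ (hPow k)) ⟩
  suc (L + (L + 1))                                 ≡⟨ double L ⟩
  2 * suc L                                         ≡⟨ cong (2 *_) (hPow-length k) ⟩
  2 ^ suc (suc k)                                   ∎
  where
  L = length (hPow k)
  double : ∀ L → suc (L + (L + 1)) ≡ 2 * suc L
  double = solve-∀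

-- The word D n with h^n(a) = D n a b^n; it satisfies D 0 = ε and D (n+1) = h(D n) a.
D : ℕ → Word
D zero    = []
D (suc n) = h (D n) ++ a ∷ []

hPow-D : ∀ n → hPow n ≡ D n ++ a ∷ replicate n b
hPow-D zero    = refl
hPow-D (suc n) = begin
  h (hPow n)                                  ≡⟨ cong h (hPow-D n) ⟩
  h (D n ++ a ∷ replicate n b)                ≡⟨ h-++ (D n) (a ∷ replicate n b) ⟩
  h (D n) ++ a ∷ a ∷ b ∷ h (replicate n b)    ≡⟨ cong (λ w → h (D n) ++ a ∷ a ∷ b ∷ w) (h-bs n) ⟩
  h (D n) ++ a ∷ a ∷ b ∷ replicate n b        ≡⟨ sym (++-assoc (h (D n)) (a ∷ []) _) ⟩
  D (suc n) ++ a ∷ replicate (suc n) b        ∎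

D-starts-with-a : ∀ n → ∃[ t ] D (suc n) ≡ a ∷ t
D-starts-with-a zero    = [] , refl
D-starts-with-a (suc n) with D-starts-with-a n
... | t , e = _ , cong (λ w → h w ++ a ∷ []) e

length-hPow : ∀ n → length (hPow n) ≡ length (D n) + suc n
length-hPow n = trans (cong length (hPow-D n))
  (trans (length-++ (D n)) (cong (λ l → length (D n) + suc l) (length-replicate n)))

-- Desubstitution.  A factorisation of h X at a suitable place lifts to a
-- factorisation of X; each lemma peels off X letter by letter.

drop-three : ∀ {x y c d e f : Letter} {xs ys : Word} → x ∷ c ∷ e ∷ xs ≡ y ∷ d ∷ f ∷ ys → xs ≡ ys
drop-three refl = refl

desub-aa : ∀ X u v → h X ≡ u ++ a ∷ a ∷ v →
  ∃[ u' ] ∃[ v' ] (X ≡ u' ++ a ∷ v') × (u ≡ h u') × (v ≡ b ∷ h v')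
desub-aa (a ∷ X) []              v e = [] , X , refl , refl , sym (∷-injectiveʳ (∷-injectiveʳ e))
desub-aa (a ∷ X) (a ∷ a ∷ b ∷ u) v e with desub-aa X u v (drop-three e)
... | u' , v' , e₁ , e₂ , e₃ = a ∷ u' , v' , cong (a ∷_) e₁ , cong (λ w → a ∷ a ∷ b ∷ w) e₂ , e₃
desub-aa (b ∷ X) (b ∷ u)         v e with desub-aa X u v (∷-injectiveʳ e)
... | u' , v' , e₁ , e₂ , e₃ = b ∷ u' , v' , cong (b ∷_) e₁ , cong (b ∷_) e₂ , e₃
desub-aa [] [] v ()
desub-aa [] (_ ∷ _) v ()
desub-aa (a ∷ X) (b ∷ u) v ()
desub-aa (a ∷ X) (a ∷ []) v ()
desub-aa (a ∷ X) (a ∷ b ∷ u) v ()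
desub-aa (a ∷ X) (a ∷ a ∷ []) v ()
desub-aa (a ∷ X) (a ∷ a ∷ a ∷ u) v ()
desub-aa (b ∷ X) [] v ()
desub-aa (b ∷ X) (a ∷ u) v ()

desub-ab : ∀ X u r → h X ≡ u ++ a ∷ b ∷ r →
  ∃[ u' ] ∃[ r' ] (X ≡ u' ++ a ∷ r') × (u ≡ h u' ++ a ∷ []) × (r ≡ h r')
desub-ab (a ∷ X) (a ∷ [])        r e = [] , X , refl , refl , sym (drop-three e)
desub-ab (a ∷ X) (a ∷ a ∷ b ∷ u) r e with desub-ab X u r (drop-three e)
... | u' , r' , e₁ , e₂ , e₃ = a ∷ u' , r' , cong (a ∷_) e₁ , cong (λ w → a ∷ a ∷ b ∷ w) e₂ , e₃
desub-ab (b ∷ X) (b ∷ u)         r e with desub-ab X u r (∷-injectiveʳ e)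
... | u' , r' , e₁ , e₂ , e₃ = b ∷ u' , r' , cong (b ∷_) e₁ , cong (b ∷_) e₂ , e₃
desub-ab [] [] r ()
desub-ab [] (_ ∷ _) r ()
desub-ab (a ∷ X) [] r ()
desub-ab (a ∷ X) (b ∷ u) r ()
desub-ab (a ∷ X) (a ∷ b ∷ u) r ()
desub-ab (a ∷ X) (a ∷ a ∷ []) r ()
desub-ab (a ∷ X) (a ∷ a ∷ a ∷ u) r ()
desub-ab (b ∷ X) [] r ()
desub-ab (b ∷ X) (a ∷ u) r ()

desub-prefix-bs : ∀ n X r → h X ≡ replicate n b ++ r →
  ∃[ r' ] (X ≡ replicate n b ++ r') × (r ≡ h r')
desub-prefix-bs zero    X       r e = X , refl , sym e
desub-prefix-bs (suc n) (b ∷ X) r e with desub-prefix-bs n X r (∷-injectiveʳ e)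
... | r' , e₁ , e₂ = r' , cong (b ∷_) e₁ , e₂
desub-prefix-bs (suc n) [] r ()
desub-prefix-bs (suc n) (a ∷ X) r ()

desub-prefix-a : ∀ X v → h X ≡ a ∷ v → ∃[ v' ] (X ≡ a ∷ v') × (v ≡ a ∷ b ∷ h v')
desub-prefix-a (a ∷ X) v e = X , refl , sym (∷-injectiveʳ e)
desub-prefix-a [] v ()
desub-prefix-a (b ∷ X) v ()

-- A block b^(n+1) of h X consists of the last letter of some h(c)
-- followed by the image of a block b^n of X.
desub-bs : ∀ n X y r → h X ≡ y ++ b ∷ replicate n b ++ r →
  ∃[ y' ] ∃[ r' ] X ≡ y' ++ replicate n b ++ r'
desub-bs n (b ∷ X) []           r e with desub-prefix-bs n X r (∷-injectiveʳ e)
... | r' , e₁ , _ = b ∷ [] , r' , cong (b ∷_) e₁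
desub-bs n (b ∷ X) (b ∷ y)      r e with desub-bs n X y r (∷-injectiveʳ e)
... | y' , r' , e₁ = b ∷ y' , r' , cong (b ∷_) e₁
desub-bs n (a ∷ X) (a ∷ a ∷ []) r e with desub-prefix-bs n X r (drop-three e)
... | r' , e₁ , _ = a ∷ [] , r' , cong (a ∷_) e₁
desub-bs n (a ∷ X) (a ∷ a ∷ b ∷ y) r e with desub-bs n X y r (drop-three e)
... | y' , r' , e₁ = a ∷ y' , r' , cong (a ∷_) e₁
desub-bs n [] [] r ()
desub-bs n [] (_ ∷ _) r ()
desub-bs n (b ∷ X) (a ∷ y) r ()
desub-bs n (a ∷ X) [] r ()
desub-bs n (a ∷ X) (b ∷ y) r ()
desub-bs n (a ∷ X) (a ∷ []) r ()
desub-bs n (a ∷ X) (a ∷ b ∷ y) r ()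
desub-bs n (a ∷ X) (a ∷ a ∷ a ∷ y) r ()

LeftContext : ℕ → Word → Set
LeftContext n u = (u ≡ D n) ⊎ ∃[ L ] (u ≡ L ++ replicate (suc n) b ++ D n)

Comparable : Word → Word → Set
Comparable x y = (∃[ t ] x ≡ y ++ t) ⊎ (∃[ t ] y ≡ x ++ t)

Comparable-h : ∀ x y → Comparable x y → Comparable (h x) (h y)
Comparable-h x y (inj₁ (t , e)) = inj₁ (h t , trans (cong h e) (h-++ y t))
Comparable-h x y (inj₂ (t , e)) = inj₂ (h t , trans (cong h e) (h-++ x t))

-- Every image h u is empty or ends with b: a left context for n = 0.
leftContext-h : ∀ u → LeftContext 0 (h u)
leftContext-h []      = inj₁ refl
leftContext-h (c ∷ u) = inj₂ (h-ends-with-b c u)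

-- Applying u ↦ h(u) a to a left context for n gives one for n + 1;
-- the alternative with empty L is excluded when u does not start with b.
leftContext-step : ∀ n u → (∀ t → u ≢ b ∷ t) → LeftContext n u → LeftContext (suc n) (h u ++ a ∷ [])
leftContext-step n u _  (inj₁ e)           = inj₁ (cong (λ w → h w ++ a ∷ []) e)
leftContext-step n u nb (inj₂ ([] , e))    = ⊥-elim (nb _ e)
leftContext-step n u _  (inj₂ (c ∷ L , e)) with h-ends-with-b c L
... | y , ey = inj₂ (y , (begin
  h u ++ a ∷ []                                                ≡⟨ cong (λ w → h w ++ a ∷ []) e ⟩
  h ((c ∷ L) ++ Bn ++ D n) ++ a ∷ []                           ≡⟨ cong (_++ a ∷ []) (h-++ (c ∷ L) (Bn ++ D n)) ⟩
  (h (c ∷ L) ++ h (Bn ++ D n)) ++ a ∷ []                       ≡⟨ cong₂ (λ p q → (p ++ q) ++ a ∷ []) ey (h-++ Bn (D n)) ⟩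
  ((y ++ b ∷ []) ++ h Bn ++ h (D n)) ++ a ∷ []                 ≡⟨ cong (λ w → ((y ++ b ∷ []) ++ w ++ h (D n)) ++ a ∷ []) (h-bs (suc n)) ⟩
  ((y ++ b ∷ []) ++ Bn ++ h (D n)) ++ a ∷ []                   ≡⟨ ++-assoc (y ++ b ∷ []) _ _ ⟩
  (y ++ b ∷ []) ++ (Bn ++ h (D n)) ++ a ∷ []                   ≡⟨ ++-assoc y (b ∷ []) _ ⟩
  y ++ b ∷ ((Bn ++ h (D n)) ++ a ∷ [])                         ≡⟨ cong (λ w → y ++ b ∷ w) (++-assoc Bn (h (D n)) _) ⟩
  y ++ replicate (suc (suc n)) b ++ D (suc n)                  ∎))
  where Bn = replicate (suc n) b

hPow-prefix-not-b : ∀ K u x → hPow K ≡ u ++ x → ∀ t → u ≢ b ∷ t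
hPow-prefix-not-b K u x e t refl with hPow-starts-with-a K
... | s , es with trans (sym es) e
... | ()

[]≢++∷ : ∀ (u : Word) c v → [] ≢ u ++ c ∷ v
[]≢++∷ []      c v ()
[]≢++∷ (_ ∷ u) c v ()

-- Induction on n: the
-- occurrence desubstitutes to an occurrence of a b^(n-1) a in h^(K-1)(a).
context : ∀ n K u v → hPow K ≡ u ++ a ∷ replicate n b ++ a ∷ v →
  LeftContext n u × Comparable (a ∷ v) (hPow n ++ b ∷ [])
context n zero []      v e = ⊥-elim ([]≢++∷ (replicate n b) a v (∷-injectiveʳ e))
context n zero (_ ∷ u) v e = ⊥-elim ([]≢++∷ u a _ (∷-injectiveʳ e))
context zero    (suc K) u v e with desub-aa (hPow K) u v e
... | u' , v' , _ , eu , ev =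
  subst (LeftContext 0) (sym eu) (leftContext-h u') , inj₁ (h v' , cong (a ∷_) ev)
context (suc n) (suc K) u v e with desub-ab (hPow K) u _ e
... | u' , r , e₁ , eu , er with desub-prefix-bs n r (a ∷ v) (sym er)
... | r' , e₂ , er' with desub-prefix-a r' v (sym er')
... | v' , e₃ , ev with context n K u' v' (trans e₁ (cong (λ w → u' ++ a ∷ w) (trans e₂ (cong (replicate n b ++_) e₃))))
... | left , right =
  subst (LeftContext (suc n)) (sym eu) (leftContext-step n u' (hPow-prefix-not-b K u' _ e₁) left) ,
  subst₂ Comparable (cong (a ∷_) (sym ev)) (h-++ (hPow n) (b ∷ [])) (Comparable-h _ _ right)

-- D (n+1) a contains no block b^(n+1): a block b^(n+2) in D (n+2) a b = h(D (n+1) a)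
-- would desubstitute to a block b^(n+1) in D (n+1) a.
no-block-in-D : ∀ n x y → D (suc n) ++ a ∷ [] ≢ x ++ replicate (suc n) b ++ y
no-block-in-D zero    []           y ()
no-block-in-D zero    (_ ∷ [])     y ()
no-block-in-D zero    (_ ∷ _ ∷ x)  y e = []≢++∷ x b y (∷-injectiveʳ (∷-injectiveʳ e))
no-block-in-D (suc n) x y e with desub-bs (suc n) (D (suc n) ++ a ∷ []) x (y ++ b ∷ []) image
  where
  Dn = D (suc n)
  Bn = replicate (suc n) b
  image : h (Dn ++ a ∷ []) ≡ x ++ b ∷ Bn ++ y ++ b ∷ []
  image = begin
    h (Dn ++ a ∷ [])                    ≡⟨ h-++ Dn (a ∷ []) ⟩
    h Dn ++ a ∷ a ∷ b ∷ []              ≡⟨ sym (++-assoc (h Dn) (a ∷ []) _) ⟩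
    D (suc (suc n)) ++ a ∷ b ∷ []       ≡⟨ sym (++-assoc (D (suc (suc n))) (a ∷ []) _) ⟩
    (D (suc (suc n)) ++ a ∷ []) ++ b ∷ [] ≡⟨ cong (_++ b ∷ []) e ⟩
    (x ++ b ∷ Bn ++ y) ++ b ∷ []        ≡⟨ ++-assoc x _ _ ⟩
    x ++ b ∷ (Bn ++ y) ++ b ∷ []        ≡⟨ cong (λ w → x ++ b ∷ w) (++-assoc Bn y _) ⟩
    x ++ b ∷ Bn ++ y ++ b ∷ []          ∎
... | x' , y' , e' = no-block-in-D n x' y' e'

hPow-prefix : ∀ k d → ∃[ t ] hPow (d + k) ≡ hPow k ++ t
hPow-prefix k zero    = [] , sym (++-identityʳ (hPow k))
hPow-prefix k (suc d) with hPow-prefix k d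
... | t , e = t ++ hPow (d + k) ++ b ∷ [] , (begin
  hPow (suc d + k)                              ≡⟨ hPow-suc (d + k) ⟩
  hPow (d + k) ++ hPow (d + k) ++ b ∷ []        ≡⟨ cong (_++ hPow (d + k) ++ b ∷ []) e ⟩
  (hPow k ++ t) ++ hPow (d + k) ++ b ∷ []       ≡⟨ ++-assoc (hPow k) t _ ⟩
  hPow k ++ t ++ hPow (d + k) ++ b ∷ []         ∎)

nth-++ˡ : ∀ x y i → i < length x → nth (x ++ y) i ≡ nth x i
nth-++ˡ (c ∷ x) y zero    _       = refl
nth-++ˡ (c ∷ x) y (suc i) (s≤s p) = nth-++ˡ x y i p

k<length-hPow : ∀ k → k < length (hPow k)
k<length-hPow k = subst (k <_) (sym (length-hPow k)) (m≤n+m (suc k) (length (D k)))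

nth-hPow-stable : ∀ k k' i → k ≤ k' → i < length (hPow k) → nth (hPow k') i ≡ nth (hPow k) i
nth-hPow-stable k k' i k≤k' i<len with m≤n⇒∃[o]m+o≡n k≤k'
... | o , eo with hPow-prefix k o
... | t , et = begin
  nth (hPow k') i          ≡⟨ cong (λ j → nth (hPow j) i) (trans (sym eo) (+-comm k o)) ⟩
  nth (hPow (o + k)) i     ≡⟨ cong (λ w → nth w i) et ⟩
  nth (hPow k ++ t) i      ≡⟨ nth-++ˡ (hPow k) t i i<len ⟩
  nth (hPow k) i           ∎

z-hPow : ∀ K i → i < length (hPow K) → z i ≡ nth (hPow K) i
z-hPow K i i<len with ≤-total (suc i) K
... | inj₁ le = sym (nth-hPow-stable (suc i) K i le (<-trans (n<1+n i) (k<length-hPow (suc i))))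
... | inj₂ le = nth-hPow-stable K (suc i) i le i<len

length-slice : ∀ p k → length (slice p k) ≡ k
length-slice p zero    = refl
length-slice p (suc k) = cong suc (length-slice (suc p) k)

nth-slice : ∀ p k t → t < k → nth (slice p k) t ≡ z (p + t)
nth-slice p (suc k) zero    _        = cong z (sym (+-identityʳ p))
nth-slice p (suc k) (suc t) (s≤s lt) = trans (nth-slice (suc p) k t lt) (cong z (sym (+-suc p t)))

slice-++ : ∀ p x y → slice p (x + y) ≡ slice p x ++ slice (p + x) y
slice-++ p zero    y = cong (λ q → slice q y) (sym (+-identityʳ p))
slice-++ p (suc x) y = cong (z p ∷_)
  (trans (slice-++ (suc p) x y) (cong (λ q → slice (suc p) x ++ slice q y) (sym (+-suc p x))))

slice-from-nth : ∀ p L → (∀ t → t < length L → z (p + t) ≡ nth L t) → slice p (length L) ≡ L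
slice-from-nth p []      f = refl
slice-from-nth p (c ∷ L) f = cong₂ _∷_ (trans (cong z (sym (+-identityʳ p))) (f 0 (s≤s z≤n)))
  (slice-from-nth (suc p) L (λ t lt → trans (cong z (sym (+-suc p t))) (f (suc t) (s≤s lt))))

Occ : ℕ → Word → Set
Occ p u = slice p (length u) ≡ u

Occ-hPow : ∀ K → Occ 0 (hPow K)
Occ-hPow K = slice-from-nth 0 (hPow K) (z-hPow K)

Occ-nth : ∀ {p u} → Occ p u → ∀ t → t < length u → z (p + t) ≡ nth u t
Occ-nth {p} {u} occ t lt = trans (sym (nth-slice p (length u) t lt)) (cong (λ w → nth w t) occ)

Occ-unique : ∀ {p u v} → Occ p u → Occ p v → length u ≡ length v → u ≡ v
Occ-unique {p} occu occv eq = trans (sym occu) (trans (cong (slice p) eq) occv)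

++-cancel-length : ∀ (x x' y y' : Word) → length x ≡ length x' → x ++ y ≡ x' ++ y' → x ≡ x' × y ≡ y'
++-cancel-length []      []       y y' _ e = refl , e
++-cancel-length (c ∷ x) (c' ∷ x') y y' l e
  with ++-cancel-length x x' y y' (suc-injective l) (∷-injectiveʳ e)
... | e₁ , e₂ = cong₂ _∷_ (∷-injectiveˡ e) e₁ , e₂

slice-++⁻ : ∀ p k u v → slice p k ≡ u ++ v → Occ p u × Occ (p + length u) v
slice-++⁻ p k u v e = ++-cancel-length _ _ _ _ (length-slice p (length u)) (begin
  slice p (length u) ++ slice (p + length u) (length v)   ≡⟨ sym (slice-++ p (length u) (length v)) ⟩
  slice p (length u + length v)                          ≡⟨ cong (slice p) (sym (length-++ u)) ⟩
  slice p (length (u ++ v))                              ≡⟨ cong (λ l → slice p (length l)) (sym e) ⟩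
  slice p (length (slice p k))                           ≡⟨ cong (slice p) (length-slice p k) ⟩
  slice p k                                              ≡⟨ e ⟩
  u ++ v                                                 ∎)

Occ-++⁺ : ∀ {p q u v} → Occ p u → Occ q v → p + length u ≡ q → Occ p (u ++ v)
Occ-++⁺ {p} {q} {u} {v} occu occv eq = begin
  slice p (length (u ++ v))                               ≡⟨ cong (slice p) (length-++ u) ⟩
  slice p (length u + length v)                          ≡⟨ slice-++ p (length u) (length v) ⟩
  slice p (length u) ++ slice (p + length u) (length v)  ≡⟨ cong₂ (λ x y → x ++ slice y (length v)) occu eq ⟩
  u ++ slice q (length v)                                ≡⟨ cong (u ++_) occv ⟩
  u ++ v                                                 ∎

Bs : ℕ → ℕ → Set
Bs p k = ∀ t → t < k → z (p + t) ≡ b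

nth-replicate : ∀ k (c : Letter) t → t < k → nth (replicate k c) t ≡ c
nth-replicate (suc k) c zero    _        = refl
nth-replicate (suc k) c (suc t) (s≤s lt) = nth-replicate k c t lt

Bs⇒Occ : ∀ {p k} → Bs p k → Occ p (replicate k b)
Bs⇒Occ {p} {k} bs = slice-from-nth p (replicate k b) λ t lt →
  let lt' = subst (t <_) (length-replicate k) lt
  in trans (bs t lt') (sym (nth-replicate k b t lt'))

Occ⇒Bs : ∀ {p k} → Occ p (replicate k b) → Bs p k
Occ⇒Bs {p} {k} occ t lt = trans (Occ-nth occ t (subst (t <_) (sym (length-replicate k)) lt)) (nth-replicate k b t lt)

Bs-tail : ∀ {p k} → Bs p (suc k) → Bs (suc p) k
Bs-tail {p} bs t lt = trans (cong z (sym (+-suc p t))) (bs (suc t) (s≤s lt))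

Bs-shorten : ∀ {p k k'} → k ≤ k' → Bs p k' → Bs p k
Bs-shorten k≤k' bs t lt = bs t (<-≤-trans lt k≤k')

a∉Bs : ∀ {p k y} → Bs p k → z y ≡ a → p ≤ y → y < p + k → ⊥
a∉Bs {p} {k} {y} bs za p≤y y<p+k with bs (y ∸ p) (+-cancelˡ-< p _ k (subst (_< p + k) (sym (m+[n∸m]≡n p≤y)) y<p+k))
... | zb with trans (sym za) (trans (cong z (sym (m+[n∸m]≡n p≤y))) zb)
... | ()

Occ-D-head : ∀ {p} n → Occ p (D (suc n)) → z p ≡ a
Occ-D-head {p} n occ with D-starts-with-a n
... | t , e = trans (cong z (sym (+-identityʳ p)))
  (trans (Occ-nth occ 0 (subst (0 <_) (cong length (sym e)) (s≤s z≤n))) (cong (λ w → nth w 0) e))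

no-block-at-D : ∀ {p x} n → Occ p (D (suc n)) → Bs x (suc n) → p ≤ x →
  x + suc n ≤ p + length (D (suc n)) → ⊥
no-block-at-D {p} {x} n occ bs p≤x end with m≤n⇒∃[o]m+o≡n p≤x | m≤n⇒∃[o]m+o≡n end
... | o₁ , e₁ | o₂ , e₂ = no-block-in-D n X (Y ++ a ∷ []) (begin
    Dn ++ a ∷ []                                ≡⟨ cong (_++ a ∷ []) (sym occ) ⟩
    slice p d ++ a ∷ []                          ≡⟨ cong (λ l → slice p l ++ a ∷ []) split-d ⟩
    slice p (o₁ + (suc n + o₂)) ++ a ∷ []        ≡⟨ cong (_++ a ∷ []) (slice-++ p o₁ _) ⟩
    (X ++ slice (p + o₁) (suc n + o₂)) ++ a ∷ [] ≡⟨ cong (λ w → (X ++ w) ++ a ∷ []) (slice-++ (p + o₁) (suc n) o₂) ⟩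
    (X ++ slice (p + o₁) (suc n) ++ Y) ++ a ∷ [] ≡⟨ cong (λ w → (X ++ w ++ Y) ++ a ∷ []) block ⟩
    (X ++ Bn ++ Y) ++ a ∷ []                     ≡⟨ ++-assoc X _ _ ⟩
    X ++ (Bn ++ Y) ++ a ∷ []                     ≡⟨ cong (X ++_) (++-assoc Bn Y _) ⟩
    X ++ Bn ++ Y ++ a ∷ []                       ∎)
  where
  Dn = D (suc n)
  d  = length Dn
  Bn = replicate (suc n) b
  X  = slice p o₁
  Y  = slice (p + o₁ + suc n) o₂
  split-d : d ≡ o₁ + (suc n + o₂)
  split-d = +-cancelˡ-≡ p _ _ (begin
    p + d                     ≡⟨ sym e₂ ⟩
    x + suc n + o₂            ≡⟨ cong (λ q → q + suc n + o₂) (sym e₁) ⟩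
    p + o₁ + suc n + o₂       ≡⟨ trans (+-assoc (p + o₁) (suc n) o₂) (+-assoc p o₁ _) ⟩
    p + (o₁ + (suc n + o₂))   ∎)
  block : slice (p + o₁) (suc n) ≡ Bn
  block = subst (λ l → slice (p + o₁) l ≡ Bn) (length-replicate (suc n))
    (Bs⇒Occ (subst (λ q → Bs q (suc n)) (sym e₁) bs))

hPow-occ : ∀ {p P} k → Occ p (D k) → p + length (D k) ≡ P → z P ≡ a → Bs (suc P) k → Occ p (hPow k)
hPow-occ {p} k occD refl za bs = subst (Occ p) (sym (hPow-D k))
  (Occ-++⁺ occD (cong₂ _∷_ za (Bs⇒Occ bs)) refl)

ZLeftContext : ℕ → ℕ → Set
ZLeftContext n P = (P ≡ length (D n) × Occ 0 (D n))
  ⊎ ∃[ e ] (P ≡ e + suc n + length (D n) × Bs e (suc n) × Occ (e + suc n) (D n))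

record RightContext (n p : ℕ) : Set where
  field
    D-occ   : Occ p (D n)
    a-after : z (p + length (D n)) ≡ a
    b-after : Bs (suc (p + length (D n))) (suc n)

replicate-snoc : ∀ k (c : Letter) → replicate k c ++ c ∷ [] ≡ c ∷ replicate k c
replicate-snoc zero    c = refl
replicate-snoc (suc k) c = cong (c ∷_) (replicate-snoc k c)

hPow-b-D : ∀ n → hPow n ++ b ∷ [] ≡ D n ++ a ∷ replicate (suc n) b
hPow-b-D n = begin
  hPow n ++ b ∷ []                       ≡⟨ cong (_++ b ∷ []) (hPow-D n) ⟩
  (D n ++ a ∷ replicate n b) ++ b ∷ []   ≡⟨ ++-assoc (D n) _ _ ⟩
  D n ++ a ∷ (replicate n b ++ b ∷ [])   ≡⟨ cong (λ w → D n ++ a ∷ w) (replicate-snoc n b) ⟩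
  D n ++ a ∷ replicate (suc n) b         ∎

rightContext : ∀ n p → Occ p (hPow n ++ b ∷ []) → RightContext n p
rightContext n p occ with slice-++⁻ p _ (D n) (a ∷ replicate (suc n) b) (trans occ (hPow-b-D n))
... | occD , occRest = record
  { D-occ   = occD
  ; a-after = ∷-injectiveˡ occRest
  ; b-after = Occ⇒Bs (∷-injectiveʳ occRest) }

zLeftContext : ∀ n P → LeftContext n (slice 0 P) → ZLeftContext n P
zLeftContext n P (inj₁ e) = inj₁ (eP , subst (λ l → slice 0 l ≡ D n) eP e)
  where eP = trans (sym (length-slice 0 P)) (cong length e)
zLeftContext n P (inj₂ (L , e)) =
  inj₂ (length L , eP , Occ⇒Bs occB , subst (λ q → Occ q (D n)) (cong (length L +_) (length-replicate (suc n))) occD)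
  where
  Bn = replicate (suc n) b
  occRest = proj₂ (slice-++⁻ 0 P L (Bn ++ D n) e)
  occB = proj₁ (slice-++⁻ (length L) _ Bn (D n) occRest)
  occD = proj₂ (slice-++⁻ (length L) _ Bn (D n) occRest)
  eP : P ≡ length L + suc n + length (D n)
  eP = begin
    P                                         ≡⟨ sym (length-slice 0 P) ⟩
    length (slice 0 P)                        ≡⟨ cong length e ⟩
    length (L ++ Bn ++ D n)                   ≡⟨ length-++ L ⟩
    length L + length (Bn ++ D n)             ≡⟨ cong (length L +_) (length-++ Bn) ⟩
    length L + (length Bn + length (D n))     ≡⟨ cong (λ l → length L + (l + length (D n))) (length-replicate (suc n)) ⟩
    length L + (suc n + length (D n))         ≡⟨ sym (+-assoc (length L) (suc n) _) ⟩
    length L + suc n + length (D n)           ∎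

comparable-prefix : ∀ x y → Comparable x y → length y ≤ length x → ∃[ t ] x ≡ y ++ t
comparable-prefix x y (inj₁ p)            _  = p
comparable-prefix x y (inj₂ ([] , e))     _  = [] , trans (sym (++-identityʳ x)) (trans (sym e) (sym (++-identityʳ y)))
comparable-prefix x y (inj₂ (c ∷ t , e)) le = ⊥-elim (<⇒≱ longer le)
  where
  longer : length x < length y
  longer = subst (length x <_) (trans (sym (length-++ x)) (cong length (sym e))) (m<m+n (length x) (s≤s z≤n))

-- Proof: inside a prefix h^M(a) of z long enough to contain the block followed
-- by |h^n(a) b| letters, apply the word lemma context.
zContext : ∀ n P → z P ≡ a → Bs (suc P) n → z (suc P + n) ≡ a →
  ZLeftContext n P × RightContext n (suc P + n)
zContext n P zP bs zPn with m≤n⇒∃[o]m+o≡n (k<length-hPow (suc P + n + g))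
  where g = length (hPow n ++ b ∷ [])
... | o , eo = zLeftContext n P left , rightContext n (suc P + n) (proj₁ (slice-++⁻ _ _ G t right-prefix))
  where
  G    = hPow n ++ b ∷ []
  g    = length G
  M    = suc P + n + g
  rest = g + o
  V    = slice (suc (suc P + n)) rest
  len : length (hPow M) ≡ P + suc (n + suc rest)
  len = trans (sym eo) (arith P n g o)
    where
    arith : ∀ P n g o → suc (suc P + n + g) + o ≡ P + suc (n + suc (g + o))
    arith = solve-∀
  decomposition : hPow M ≡ slice 0 P ++ a ∷ replicate n b ++ a ∷ V
  decomposition = begin
    hPow M                                                       ≡⟨ sym (Occ-hPow M) ⟩
    slice 0 (length (hPow M))                                    ≡⟨ cong (slice 0) len ⟩
    slice 0 (P + suc (n + suc rest))                             ≡⟨ slice-++ 0 P _ ⟩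
    slice 0 P ++ z P ∷ slice (suc P) (n + suc rest)              ≡⟨ cong (λ w → slice 0 P ++ z P ∷ w) (slice-++ (suc P) n _) ⟩
    slice 0 P ++ z P ∷ slice (suc P) n ++ z (suc P + n) ∷ V      ≡⟨ cong₂ (λ c w → slice 0 P ++ c ∷ w ++ z (suc P + n) ∷ V) zP
                                                                           (subst (λ l → slice (suc P) l ≡ replicate n b) (length-replicate n) (Bs⇒Occ bs)) ⟩
    slice 0 P ++ a ∷ replicate n b ++ z (suc P + n) ∷ V          ≡⟨ cong (λ c → slice 0 P ++ a ∷ replicate n b ++ c ∷ V) zPn ⟩
    slice 0 P ++ a ∷ replicate n b ++ a ∷ V                      ∎
  ctx = context n M (slice 0 P) V decomposition
  left = proj₁ ctx
  long-enough : g ≤ length (a ∷ V)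
  long-enough = subst (g ≤_) (sym (cong suc (length-slice _ rest))) (≤-trans (m≤m+n g o) (n≤1+n rest))
  prefix = comparable-prefix (a ∷ V) G (proj₂ ctx) long-enough
  t = proj₁ prefix
  right-prefix : slice (suc P + n) (suc rest) ≡ G ++ t
  right-prefix = trans (cong (_∷ V) zPn) (proj₂ prefix)

At→nth : ∀ w j c → At w j c → nth w j ≡ c
At→nth (x ∷ w) zero    c (r , e) = ∷-injectiveˡ e
At→nth (x ∷ w) (suc j) c at      = At→nth w j c at
At→nth []      zero    c (r , ())
At→nth []      (suc j) c (r , ())

nth→At : ∀ w j c → j < length w → nth w j ≡ c → At w j c
nth→At (x ∷ w) zero    c _        e = w , cong (_∷ w) e
nth→At (x ∷ w) (suc j) c (s≤s lt) e = nth→At w j c lt e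

¬At-end : ∀ w c → ¬ At w (length w) c
¬At-end []      c (r , ())
¬At-end (x ∷ w) c at = ¬At-end w c at

nth-drop : ∀ (w : Word) i t → nth (drop i w) t ≡ nth w (i + t)
nth-drop w       zero    t = refl
nth-drop []      (suc i) t = refl
nth-drop (c ∷ w) (suc i) t = nth-drop w i t

nth-take : ∀ (w : Word) k t → t < k → nth (take k w) t ≡ nth w t
nth-take []      (suc k) t       _        = refl
nth-take (c ∷ w) (suc k) zero    _        = refl
nth-take (c ∷ w) (suc k) (suc t) (s≤s lt) = nth-take w k t lt

BlockIn : Word → ℕ → ℕ → Set
BlockIn w i k = ∀ t → t < k → nth w (i + t) ≡ b

take-drop-block : ∀ (w : Word) i k → i + k ≤ length w → BlockIn w i k → take k (drop i w) ≡ replicate k b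
take-drop-block (x ∷ w) (suc i) k       (s≤s le) bl = take-drop-block w i k le bl
take-drop-block w       zero    zero    _        bl = refl
take-drop-block (x ∷ w) zero    (suc k) (s≤s le) bl =
  cong₂ _∷_ (bl 0 (s≤s z≤n)) (take-drop-block w 0 k le (λ t lt → bl (suc t) (s≤s lt)))
take-drop-block []      (suc i) k       ()
take-drop-block []      zero    (suc k) ()

a≢b : a ≢ b
a≢b ()

LeftEnd : Word → ℕ → Set
LeftEnd w i = (i ≡ 0) ⊎ ∃[ j ] ((i ≡ suc j) × ¬ At w j b)

run-intro : ∀ w i k → 1 ≤ k → i + k ≤ length w → BlockIn w i k → LeftEnd w i →
  (i + k ≡ length w ⊎ nth w (i + k) ≡ a) → RunOcc w i k
run-intro w i k k≥1 fits bl left right =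
  k≥1 , subst (_≤ length w) (+-comm i k) fits , take-drop-block w i k fits bl , left , right-end right
  where
  right-end : (i + k ≡ length w ⊎ nth w (i + k) ≡ a) → ¬ At w (i + k) b
  right-end (inj₁ e) at = ¬At-end w b (subst (λ q → At w q b) e at)
  right-end (inj₂ e) at = a≢b (trans (sym e) (At→nth w (i + k) b at))

RunAtLeast : Word → ℕ → Set
RunAtLeast w k = ∃[ i ] ∃[ k' ] (k ≤ k' × RunOcc w i k')

RunAtLeast-pred : ∀ {w k} → RunAtLeast w (suc k) → RunAtLeast w k
RunAtLeast-pred {k = k} (i , k' , le , run) = i , k' , ≤-trans (n≤1+n k) le , run

extend-right : ∀ f w i k → i + k + f ≡ length w → 1 ≤ k → BlockIn w i k → LeftEnd w i → RunAtLeast w k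
extend-right zero    w i k e k≥1 bl left =
  i , k , ≤-refl , run-intro w i k k≥1 (≤-reflexive e') bl left (inj₁ e')
  where e' = trans (sym (+-identityʳ _)) e
extend-right (suc f) w i k e k≥1 bl left with nth w (i + k) in eq
... | a = i , k , ≤-refl , run-intro w i k k≥1 (subst (i + k ≤_) e (m≤m+n (i + k) (suc f))) bl left (inj₂ eq)
... | b = RunAtLeast-pred (extend-right f w i (suc k) (trans shift e) (s≤s z≤n) longer left)
  where
  shift : i + suc k + f ≡ i + k + suc f
  shift = trans (cong (_+ f) (+-suc i k)) (sym (+-suc (i + k) f))
  longer : BlockIn w i (suc k)
  longer t lt with m<1+n⇒m<n∨m≡n lt
  ... | inj₁ t<k  = bl t t<k
  ... | inj₂ refl = eq

-- Every block of b's lies in a run: extend it to the left, then to the right.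
block-in-run : ∀ w q k → 1 ≤ k → q + k ≤ length w → BlockIn w q k → RunAtLeast w k
block-in-run w zero    k k≥1 fits bl = extend-right (length w ∸ k) w 0 k (m+[n∸m]≡n fits) k≥1 bl (inj₁ refl)
block-in-run w (suc q) k k≥1 fits bl with nth w q in eq
... | a = extend-right (length w ∸ (suc q + k)) w (suc q) k (m+[n∸m]≡n fits) k≥1 bl
            (inj₂ (q , refl , λ at → a≢b (trans (sym eq) (At→nth w q b at))))
... | b = RunAtLeast-pred (block-in-run w q (suc k) (s≤s z≤n) (subst (_≤ length w) (sym (+-suc q k)) fits) longer)
  where
  longer : BlockIn w q (suc k)
  longer zero    _        = trans (cong (nth w) (+-identityʳ q)) eq
  longer (suc t) (s≤s lt) = trans (cong (nth w) (+-suc q t)) (bl t lt)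

no-block-beyond-longest : ∀ w n → LongestRun w n → ∀ q → q + suc n ≤ length w → BlockIn w q (suc n) → ⊥
no-block-beyond-longest w n (_ , longest) q fits bl with block-in-run w q (suc n) (s≤s z≤n) fits bl
... | i , k' , le , run = 1+n≰n (≤-trans le (longest i k' run))

not-b⇒a : ∀ (c : Letter) → c ≢ b → c ≡ a
not-b⇒a a _   = refl
not-b⇒a b c≢b = ⊥-elim (c≢b refl)

record RunInZ (s m i k : ℕ) : Set where
  field
    fits      : i + k ≤ m
    block     : Bs (s + i) k
    left-end  : (i ≡ 0) ⊎ ∃[ P ] (suc P ≡ s + i × z P ≡ a)
    right-end : (i + k ≡ m) ⊎ z (s + i + k) ≡ a

runInZ : ∀ s m i k → RunOcc (slice s m) i k → RunInZ s m i k
runInZ s m i k (_ , fits' , run-bs , left , right) = record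
  { fits = fits ; block = block ; left-end = left-end left ; right-end = right-end }
  where
  w = slice s m
  fits : i + k ≤ m
  fits = subst₂ _≤_ (+-comm k i) (length-slice s m) fits'
  letter : ∀ j → j < m → z (s + j) ≡ nth w j
  letter j lt = sym (nth-slice s m j lt)
  block : Bs (s + i) k
  block t lt = begin
    z (s + i + t)                  ≡⟨ cong z (+-assoc s i t) ⟩
    z (s + (i + t))                ≡⟨ letter (i + t) (<-≤-trans (+-monoʳ-< i lt) fits) ⟩
    nth w (i + t)                  ≡⟨ sym (nth-drop w i t) ⟩
    nth (drop i w) t               ≡⟨ sym (nth-take (drop i w) k t lt) ⟩
    nth (take k (drop i w)) t      ≡⟨ cong (λ v → nth v t) run-bs ⟩
    nth (replicate k b) t          ≡⟨ nth-replicate k b t lt ⟩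
    b                              ∎
  a-at : ∀ j → j < m → ¬ At w j b → z (s + j) ≡ a
  a-at j lt ¬at = not-b⇒a _ λ zb →
    ¬at (nth→At w j b (subst (j <_) (sym (length-slice s m)) lt) (trans (sym (letter j lt)) zb))
  left-end : LeftEnd w i → (i ≡ 0) ⊎ ∃[ P ] (suc P ≡ s + i × z P ≡ a)
  left-end (inj₁ i≡0)             = inj₁ i≡0
  left-end (inj₂ (j , refl , ¬at)) = inj₂ (s + j , sym (+-suc s j) , a-at j (≤-trans (m≤m+n (suc j) k) fits) ¬at)
  right-end : (i + k ≡ m) ⊎ z (s + i + k) ≡ a
  right-end with m≤n⇒m<n∨m≡n fits
  ... | inj₂ e  = inj₁ e
  ... | inj₁ lt = inj₂ (trans (cong z (+-assoc s i k)) (a-at (i + k) lt right))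

no-block-in-factor : ∀ s m n → LongestRun (slice s m) n → ∀ q → s ≤ q → q + suc n ≤ s + m → Bs q (suc n) → ⊥
no-block-in-factor s m n longest q s≤q end bs =
  no-block-beyond-longest (slice s m) n longest o fits block
  where
  o = q ∸ s
  q≡s+o : q ≡ s + o
  q≡s+o = sym (m+[n∸m]≡n s≤q)
  fits-m : o + suc n ≤ m
  fits-m = +-cancelˡ-≤ s _ _ (subst (_≤ s + m) (trans (cong (_+ suc n) q≡s+o) (+-assoc s o (suc n))) end)
  fits : o + suc n ≤ length (slice s m)
  fits = subst (o + suc n ≤_) (sym (length-slice s m)) fits-m
  block : BlockIn (slice s m) o (suc n)
  block t lt = begin
    nth (slice s m) (o + t)   ≡⟨ nth-slice s m (o + t) (<-≤-trans (+-monoʳ-< o lt) fits-m) ⟩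
    z (s + (o + t))           ≡⟨ cong z (sym (trans (cong (_+ t) q≡s+o) (+-assoc s o t))) ⟩
    z (q + t)                 ≡⟨ bs t lt ⟩
    b                         ∎

-- Let a b^(n+1) a be isolated at P, so that z continues with
-- D a b^(n+2) from p = P + n + 2, the a being at r = p + |D|.  A block b^(n+1)
-- preceded by an a at Q > P can then only start right after r, or lie beyond
-- the block b^(n+2): D a has no block b^(n+1), and an a is never inside a block.
next-block : ∀ n P Q → Bs (suc P) (suc n) → RightContext (suc n) (suc P + suc n) →
  P < Q → z Q ≡ a → Bs (suc Q) (suc n) →
  (Q ≡ suc P + suc n + length (D (suc n))) ⊎ (suc (suc P + suc n + length (D (suc n))) + suc (suc n) ≤ Q)
next-block n P Q bsP ctx P<Q zQ bsQ with <-≤-connex Q (suc P + suc n)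
... | inj₁ Q<p = ⊥-elim (a∉Bs bsP zQ P<Q Q<p)
... | inj₂ p≤Q with <-cmp Q (suc P + suc n + length (D (suc n)))
...   | tri≈ _ Q≡r _ = inj₁ Q≡r
...   | tri< Q<r _ _ = case ≤-<-connex (suc Q + suc n) (suc P + suc n + length (D (suc n))) of λ where
          (inj₁ inside-D) → ⊥-elim (no-block-at-D n D-occ bsQ (≤-trans p≤Q (n≤1+n Q)) inside-D)
          (inj₂ covers-r) → ⊥-elim (a∉Bs bsQ a-after Q<r covers-r)
  where open RightContext ctx
...   | tri> _ _ r<Q = case <-≤-connex Q (suc (suc P + suc n + length (D (suc n))) + suc (suc n)) of λ where
          (inj₁ in-block) → ⊥-elim (a∉Bs b-after zQ r<Q in-block)
          (inj₂ beyond)   → inj₂ beyond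
  where open RightContext ctx

-- Let a b^(n+1) a be isolated at P.  A block b^(n+1) at R ≤ P
-- followed by an a must end before P; as D has no block b^(n+1), P has the
-- left context b^(n+2) D with the b's at some e, and the block either is the
-- tail of these b's (R = e + 1) or ends before them.
prev-block : ∀ n P R → z P ≡ a → ZLeftContext (suc n) P → R ≤ P → Bs R (suc n) → z (R + suc n) ≡ a →
  ∃[ e ] (P ≡ e + suc (suc n) + length (D (suc n)) × Bs e (suc (suc n)) × Occ (e + suc (suc n)) (D (suc n))
          × ((R ≡ suc e) ⊎ (R + suc n < e)))
prev-block n P R zP ctx R≤P bsR zR with <-≤-connex P (R + suc n)
... | inj₁ P<end = ⊥-elim (a∉Bs bsR zP R≤P P<end)
... | inj₂ end≤P with ctx
...   | inj₁ (P≡d , occD) = ⊥-elim (no-block-at-D n occD bsR z≤n (subst (R + suc n ≤_) P≡d end≤P))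
...   | inj₂ (e , eP , bsE , occD) with <-cmp (R + suc n) (e + suc (suc n))
...     | tri≈ _ end≡E _ = e , eP , bsE , occD , inj₁ (+-cancelʳ-≡ (suc n) R (suc e) (trans end≡E (+-suc e (suc n))))
...     | tri< end<E _ _ = case ≤-<-connex e (R + suc n) of λ where
            (inj₁ e≤end) → ⊥-elim (a∉Bs bsE zR e≤end end<E)
            (inj₂ end<e) → e , eP , bsE , occD , inj₂ end<e
...     | tri> _ _ E<end = case ≤-<-connex (e + suc (suc n)) R of λ where
            (inj₁ E≤R) → ⊥-elim (no-block-at-D n occD bsR E≤R (subst (R + suc n ≤_) eP end≤P))
            (inj₂ R<E) → ⊥-elim (a∉Bs bsR (Occ-D-head n occD) (<⇒≤ R<E) E<end)

before-last : ∀ {s m n i i₃} → RunInZ s m i (suc n) → RunInZ s m i₃ (suc n) → i < i₃ → z (s + i + suc n) ≡ a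
before-last {s} {m} {n} {i} {i₃} r r₃ i<i₃ = end (RunInZ.right-end r)
  where
  end : (i + suc n ≡ m) ⊎ z (s + i + suc n) ≡ a → z (s + i + suc n) ≡ a
  end (inj₂ za)     = za
  end (inj₁ i+N≡m) = ⊥-elim (<⇒≱ (+-monoˡ-< (suc n) i<i₃) (subst (i₃ + suc n ≤_) (sym i+N≡m) (RunInZ.fits r₃)))

after-first : ∀ {s m k i j} → RunInZ s m i k → j < i → ∃[ P ] (suc P ≡ s + i × z P ≡ a)
after-first {s} {i = i} r j<i = start (RunInZ.left-end r)
  where
  start : (i ≡ 0) ⊎ ∃[ P ] (suc P ≡ s + i × z P ≡ a) → ∃[ P ] (suc P ≡ s + i × z P ≡ a)
  start (inj₂ P)    = P
  start (inj₁ refl) = ⊥-elim (<⇒≱ j<i z≤n)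

last-run : ∀ s m n P Q {i₃} → LongestRun (slice s m) (suc n) → s ≤ suc P →
  Bs (suc P) (suc n) → RightContext (suc n) (suc P + suc n) →
  P < Q → suc Q ≡ s + i₃ → z Q ≡ a → RunInZ s m i₃ (suc n) →
  (Q ≡ suc P + suc n + length (D (suc n))) × (i₃ + suc n ≡ m)
last-run s m n P Q {i₃} longest s≤sP bsP right P<Q sQ zQ r₃
  with next-block n P Q bsP right P<Q zQ (subst (λ x → Bs x (suc n)) (sym sQ) (RunInZ.block r₃))
... | inj₂ beyond = ⊥-elim (no-block-in-factor s m (suc n) longest _ s≤r beyond-end (RightContext.b-after right))
  where
  s≤r : s ≤ suc (suc P + suc n + length (D (suc n)))
  s≤r = ≤-trans s≤sP (≤-trans (≤-trans (m≤m+n (suc P) (suc n)) (m≤m+n _ _)) (n≤1+n _))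
  beyond-end : suc (suc P + suc n + length (D (suc n))) + suc (suc n) ≤ s + m
  beyond-end = ≤-trans beyond (<⇒≤ (subst (_≤ s + m) (sym sQ) (+-monoʳ-≤ s (m+n≤o⇒m≤o i₃ (RunInZ.fits r₃)))))
... | inj₁ Q≡r with RunInZ.right-end r₃
...   | inj₁ ends = Q≡r , ends
...   | inj₂ za = ⊥-elim (a≢b (trans (sym za) (trans (cong (λ x → z (x + suc n)) (trans (sym sQ) (cong suc Q≡r)))
                                                 (RightContext.b-after right (suc n) (n<1+n (suc n))))))

record FirstRun (s n i₁ P : ℕ) : Set where
  field
    e        : ℕ
    starts   : i₁ ≡ 0
    s≡e+1    : s ≡ suc e
    P≡       : P ≡ e + suc (suc n) + length (D (suc n))
    bs-e     : Bs e (suc (suc n))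
    D-before : Occ (e + suc (suc n)) (D (suc n))

first-run : ∀ s m n P {i₁} → LongestRun (slice s m) (suc n) → z P ≡ a → ZLeftContext (suc n) P →
  s + i₁ ≤ P → P < s + m → RunInZ s m i₁ (suc n) → z (s + i₁ + suc n) ≡ a → FirstRun s n i₁ P
first-run s m n P {i₁} longest zP left R≤P P<end r₁ zR with prev-block n P (s + i₁) zP left R≤P (RunInZ.block r₁) zR
... | e , eP , bsE , occD , inj₂ R+N<e = ⊥-elim (no-block-in-factor s m (suc n) longest e s≤e E≤end bsE)
  where
  s≤e : s ≤ e
  s≤e = ≤-trans (m≤m+n s i₁) (≤-trans (m≤m+n (s + i₁) (suc n)) (<⇒≤ R+N<e))
  E≤end : e + suc (suc n) ≤ s + m
  E≤end = ≤-trans (subst (e + suc (suc n) ≤_) (sym eP) (m≤m+n _ _)) (<⇒≤ P<end)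
... | e , eP , bsE , occD , inj₁ R≡e+1 with RunInZ.left-end r₁
...   | inj₁ i₁≡0 = record
  { e = e ; starts = i₁≡0 ; s≡e+1 = trans (sym (trans (cong (s +_) i₁≡0) (+-identityʳ s))) R≡e+1
  ; P≡ = eP ; bs-e = bsE ; D-before = occD }
...   | inj₂ (P₁ , sP₁ , zP₁) = ⊥-elim (a≢b (trans (sym zP₁)
          (trans (cong z (trans (suc-injective (trans sP₁ R≡e+1)) (sym (+-identityʳ e)))) (bsE 0 (s≤s z≤n)))))

factor-length : ∀ e d N P s i₃ m → s ≡ suc e → P ≡ e + suc N + d →
  s + i₃ ≡ suc (suc P + N + d) → i₃ + N ≡ m → m ≡ N + ((d + suc N) + (d + suc N))
factor-length e d N P s i₃ m refl refl e₃ refl = +-cancelˡ-≡ (suc e) _ _ (begin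
  suc e + (i₃ + N)                            ≡⟨ sym (+-assoc (suc e) i₃ N) ⟩
  suc e + i₃ + N                              ≡⟨ cong (_+ N) e₃ ⟩
  suc (suc (e + suc N + d) + N + d) + N       ≡⟨ arith e d N ⟩
  suc e + (N + ((d + suc N) + (d + suc N)))   ∎)
  where
  arith : ∀ e d N → suc (suc (e + suc N + d) + N + d) + N ≡ suc e + (N + ((d + suc N) + (d + suc N)))
  arith = solve-∀

-- Once the first and last runs are located, the factor reads b^N h^N(a) h^N(a):
-- the b^N ending the block at e, h^N(a) = D a b^N around the middle run, and
-- h^N(a) = D a b^N after it.
factor-word : ∀ s m n P {i₃} → FirstRun s n 0 P → z P ≡ a → Bs (suc P) (suc n) →
  RightContext (suc n) (suc P + suc n) → s + i₃ ≡ suc (suc P + suc n + length (D (suc n))) → i₃ + suc n ≡ m →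
  slice s m ≡ replicate (suc n) b ++ hPow (suc n) ++ hPow (suc n)
factor-word s m n P {i₃} first zP bsP right last-start last-end = Occ-unique (cong (slice s) (length-slice s m)) occ length-eq
  where
  open FirstRun first
  open RightContext right
  N = suc n
  d = length (D N)
  H = hPow N
  occB : Occ s (replicate N b)
  occB = Bs⇒Occ (subst (λ x → Bs x N) (sym s≡e+1) (Bs-tail {e} {N} bs-e))
  occH₁ : Occ (s + N) H
  occH₁ = subst (λ x → Occ x H) (trans (+-suc e N) (cong (_+ N) (sym s≡e+1))) (hPow-occ N D-before (sym P≡) zP bsP)
  occH₂ : Occ (suc P + N) H
  occH₂ = hPow-occ N D-occ refl a-after (Bs-shorten {suc (suc P + N + d)} (n≤1+n N) b-after)
  H-follows-H : s + N + length H ≡ suc P + N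
  H-follows-H = begin
    s + N + length H            ≡⟨ cong₂ (λ x y → x + N + y) s≡e+1 (length-hPow N) ⟩
    suc e + N + (d + suc N)     ≡⟨ arith e N d ⟩
    suc (e + suc N + d) + N     ≡⟨ cong (λ x → suc x + N) (sym P≡) ⟩
    suc P + N                   ∎
    where
    arith : ∀ e N d → suc e + N + (d + suc N) ≡ suc (e + suc N + d) + N
    arith = solve-∀
  occ : Occ s (replicate N b ++ H ++ H)
  occ = Occ-++⁺ occB (Occ-++⁺ occH₁ occH₂ H-follows-H) (cong (s +_) (length-replicate N))
  length-eq : length (slice s m) ≡ length (replicate N b ++ H ++ H)
  length-eq = begin
    length (slice s m)                       ≡⟨ length-slice s m ⟩
    m                                        ≡⟨ factor-length e d N P s i₃ m s≡e+1 P≡ last-start last-end ⟩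
    N + ((d + suc N) + (d + suc N))          ≡⟨ cong (λ l → N + (l + l)) (sym (length-hPow N)) ⟩
    N + (length H + length H)                ≡⟨ cong₂ _+_ (sym (length-replicate N)) (sym (length-++ H)) ⟩
    length (replicate N b) + length (H ++ H) ≡⟨ sym (length-++ (replicate N b)) ⟩
    length (replicate N b ++ H ++ H)         ∎

-- Analysis of three occurrences i₁ < i₂ < i₃ of a longest run b^N in the
-- factor slice s m: the middle one is isolated, so the context lemma applies.
three-runs : ∀ s m n {i₁ i₂ i₃} → LongestRun (slice s m) (suc n) → i₁ < i₂ → i₂ < i₃ →
  RunInZ s m i₁ (suc n) → RunInZ s m i₂ (suc n) → RunInZ s m i₃ (suc n) →
  (i₁ ≡ 0) × (i₃ + suc n ≡ m) × (slice s m ≡ replicate (suc n) b ++ hPow (suc n) ++ hPow (suc n))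
three-runs s m n {i₁} {i₂} {i₃} longest i₁<i₂ i₂<i₃ r₁ r₂ r₃
  with after-first r₂ i₁<i₂ | after-first r₃ i₂<i₃
... | P , sP , zP | Q , sQ , zQ = FirstRun.starts first , proj₂ last , factor-word s m n P first' zP bsP right sQ' (proj₂ last)
  where
  N = suc n
  bsP : Bs (suc P) N
  bsP = subst (λ x → Bs x N) (sym sP) (RunInZ.block r₂)
  zPN : z (suc P + N) ≡ a
  zPN = trans (cong (λ x → z (x + N)) sP) (before-last r₂ r₃ i₂<i₃)
  contexts = zContext N P zP bsP zPN
  right = proj₂ contexts
  sP≤end : suc P ≤ s + m
  sP≤end = subst (_≤ s + m) (sym sP) (+-monoʳ-≤ s (≤-trans (<⇒≤ i₂<i₃) (m+n≤o⇒m≤o i₃ (RunInZ.fits r₃))))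
  last = last-run s m n P Q longest (subst (s ≤_) (sym sP) (m≤m+n s i₂)) bsP right
           (≤-pred (subst₂ _<_ (sym sP) (sym sQ) (+-monoʳ-< s i₂<i₃))) sQ zQ r₃
  sQ' : s + i₃ ≡ suc (suc P + N + length (D N))
  sQ' = trans (sym sQ) (cong suc (proj₁ last))
  first = first-run s m n P longest zP (proj₁ contexts)
            (≤-pred (subst (s + i₁ <_) (sym sP) (+-monoʳ-< s i₁<i₂))) sP≤end r₁ (before-last r₁ r₃ (<-trans i₁<i₂ i₂<i₃))
  first' : FirstRun s n 0 P
  first' = subst (λ i → FirstRun s n i P) (FirstRun.starts first) first

shape-snoc : ∀ N → (replicate N b ++ hPow N ++ hPow N) ++ b ∷ [] ≡ replicate N b ++ hPow (N + 1)
shape-snoc N = begin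
  (replicate N b ++ hPow N ++ hPow N) ++ b ∷ []   ≡⟨ ++-assoc (replicate N b) _ _ ⟩
  replicate N b ++ (hPow N ++ hPow N) ++ b ∷ []   ≡⟨ cong (replicate N b ++_) (++-assoc (hPow N) _ _) ⟩
  replicate N b ++ hPow N ++ hPow N ++ b ∷ []     ≡⟨ cong (replicate N b ++_) (sym (hPow-suc N)) ⟩
  replicate N b ++ hPow (suc N)                   ≡⟨ cong (λ k → replicate N b ++ hPow k) (+-comm 1 N) ⟩
  replicate N b ++ hPow (N + 1)                   ∎

shape-length : ∀ N → length (replicate N b ++ hPow N ++ hPow N) ≡ 2 ^ (N + 2) + N ∸ 2
shape-length N = begin
  length (replicate N b ++ H ++ H)   ≡⟨ length-++ (replicate N b) ⟩
  length (replicate N b) + length (H ++ H)  ≡⟨ cong₂ _+_ (length-replicate N) (length-++ H) ⟩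
  N + (L + L)                        ≡⟨ sym (m+n∸n≡m _ 2) ⟩
  N + (L + L) + 2 ∸ 2                ≡⟨ cong (_∸ 2) (arith N L) ⟩
  2 * suc L + N ∸ 2                  ≡⟨ cong (λ x → 2 * x + N ∸ 2) (hPow-length N) ⟩
  2 ^ (2 + N) + N ∸ 2                ≡⟨ cong (λ k → 2 ^ k + N ∸ 2) (+-comm 2 N) ⟩
  2 ^ (N + 2) + N ∸ 2                ∎
  where
  H = hPow N
  L = length H

  arith : ∀ N L → N + (L + L) + 2 ≡ 2 * suc L + N
  arith = solve-∀

no-run-after-end : ∀ s m N {i₃ i₄} → i₃ + N ≡ m → i₃ < i₄ → RunInZ s m i₄ N → ⊥
no-run-after-end s m N ends i₃<i₄ r₄ = <⇒≱ (+-monoˡ-< N i₃<i₄) (subst (_ ≤_) (sym ends) (RunInZ.fits r₄))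

three-run-shape : ∀ s m N {i₁ i₂ i₃} → i₁ < i₂ → i₂ < i₃ →
  (i₁ ≡ 0) × (i₃ + N ≡ m) × (slice s m ≡ replicate N b ++ hPow N ++ hPow N) →
  (i₁ ≡ 0) × (i₃ + N ≡ length (slice s m)) × (i₂ ≢ 0) × (i₂ + N ≢ length (slice s m))
  × (slice s m ++ (b ∷ []) ≡ replicate N b ++ hPow (N + 1)) × (length (slice s m) ≡ 2 ^ (N + 2) + N ∸ 2)
three-run-shape s m N i₁<i₂ i₂<i₃ (starts , ends , shape) =
  starts , trans ends |w|≡m , (λ { refl → <⇒≱ i₁<i₂ z≤n }) ,
  (λ i₂-ends → <-irrefl (trans i₂-ends (sym (trans ends |w|≡m))) (+-monoˡ-< N i₂<i₃)) ,
  trans (cong (_++ b ∷ []) shape) (shape-snoc N) , trans (cong length shape) (shape-length N)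
  where |w|≡m = sym (length-slice s m)

corollary8 : (w : Word) → Factor w → (n : ℕ) → LongestRun w n →
    ((i₁ i₂ i₃ i₄ : ℕ) → i₁ < i₂ → i₂ < i₃ → i₃ < i₄ →
      RunOcc w i₁ n → RunOcc w i₂ n → RunOcc w i₃ n → RunOcc w i₄ n → ⊥)
    × ((i₁ i₂ i₃ : ℕ) → i₁ < i₂ → i₂ < i₃ →
      RunOcc w i₁ n → RunOcc w i₂ n → RunOcc w i₃ n →
        (i₁ ≡ 0) × (i₃ + n ≡ length w) × (i₂ ≢ 0) × (i₂ + n ≢ length w)
        × (w ++ (b ∷ []) ≡ replicate n b ++ hPow (n + 1))
        × (length w ≡ 2 ^ (n + 2) + n ∸ 2))
corollary8 w (s , m , refl) zero    ((_ , run) , _) = ⊥-elim (1+n≰n (proj₁ run))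
corollary8 w (s , m , refl) (suc n) longest =
  (λ i₁ i₂ i₃ i₄ l₁₂ l₂₃ l₃₄ o₁ o₂ o₃ o₄ →
     no-run-after-end s m (suc n) (proj₁ (proj₂ (analysis l₁₂ l₂₃ o₁ o₂ o₃))) l₃₄ (runInZ s m i₄ (suc n) o₄)) ,
  (λ i₁ i₂ i₃ l₁₂ l₂₃ o₁ o₂ o₃ → three-run-shape s m (suc n) l₁₂ l₂₃ (analysis l₁₂ l₂₃ o₁ o₂ o₃))
  where
  analysis : ∀ {i₁ i₂ i₃} → i₁ < i₂ → i₂ < i₃ →
    RunOcc w i₁ (suc n) → RunOcc w i₂ (suc n) → RunOcc w i₃ (suc n) →
    (i₁ ≡ 0) × (i₃ + suc n ≡ m) × (w ≡ replicate (suc n) b ++ hPow (suc n) ++ hPow (suc n))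
  analysis l₁₂ l₂₃ o₁ o₂ o₃ =
    three-runs s m n longest l₁₂ l₂₃ (runInZ s m _ _ o₁) (runInZ s m _ _ o₂) (runInZ s m _ _ o₃)
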